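{- For every integer $n\ge 1$, $\mathrm{a}_{001,100}(n)=F_{n+2}-1$, where $(F_m)$ is the Fibonacci sequence with $F_0=0$, $F_1=1$, $F_{m}=F_{m-1}+F_{m-2}$.
   Context: An ascent of an integer word $x_1\cdots x_n$ is an index $j$ with $x_j<x_{j+1}$; $\mathrm{asc}(x_1\cdots x_n)$ denotes the number of ascents. An ascent sequence of length $n$ is a sequence $x_1\cdots x_n$ of nonnegative integers with $x_1=0$ and $x_i\le \mathrm{asc}(x_1\cdots x_{i-1})+1$ for all $1<i\le n$. A pattern is a word $p=p_1\cdots p_k$ of nonnegative integers whose set of values is $\{0,1,\dots,m\}$ for some $m$. A word $x_1\cdots x_n$ contains $p$ if there are indices $i_1<\cdots<i_k$ such that $x_{i_1}\cdots x_{i_k}$ is order-isomorphic to $p$ (i.e. for all $s,t$, $x_{i_s}<x_{i_t}$ iff $p_s<p_t$ and $x_{i_s}=x_{i_t}$ iff $p_s=p_t$); otherwise it avoids $p$. For a list $B$ of patterns, $\mathcal{A}_B(n)$ is the set of ascent sequences of length $n$ avoiding every pattern in $B$, and $\mathrm{a}_B(n)=|\mathcal{A}_B(n)|$. -}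

module Defs where

open import Data.Nat using (ℕ; zero; suc; _+_; _∸_; _<_; _≤_; _<?_)
open import Data.List using (List; []; _∷_; _++_; [_]; length; lookup)
open import Data.List.Relation.Binary.Sublist.Propositional using (_⊆_)
open import Data.Fin using (Fin)
open import Data.Product using (Σ; _×_; ∃-syntax)
open import Function.Bundles using (_⇔_)
open import Relation.Nullary using (yes; no; ¬_)
open import Relation.Binary.PropositionalEquality using (_≡_)

fib : ℕ → ℕ
fib zero = 0
fib (suc zero) = 1
fib (suc (suc m)) = fib (suc m) + fib m

isAsc : ℕ → ℕ → ℕ
isAsc x y with x <? y
... | yes _ = 1
... | no _ = 0

asc : List ℕ → ℕ
asc [] = 0
asc (x ∷ []) = 0
asc (x ∷ y ∷ w) = isAsc x y + asc (y ∷ w)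

data AscSeq : List ℕ → Set where
  first : AscSeq [ 0 ]
  snoc  : ∀ {w} (x : ℕ) → AscSeq w → x ≤ suc (asc w) → AscSeq (w ++ [ x ])

OrderIso : List ℕ → List ℕ → Set
OrderIso y p =
  Σ (length y ≡ length p) λ eq →
    ∀ (s t : Fin (length y)) →
      ((lookup y s < lookup y t) ⇔ (lookup p (Data.Fin.cast eq s) < lookup p (Data.Fin.cast eq t)))
      × ((lookup y s ≡ lookup y t) ⇔ (lookup p (Data.Fin.cast eq s) ≡ lookup p (Data.Fin.cast eq t)))
  where import Data.Fin

Contains : List ℕ → List ℕ → Set
Contains x p = ∃[ y ] (y ⊆ x × OrderIso y p)

Avoids : List ℕ → List ℕ → Set
Avoids x p = ¬ Contains x p

InA : ℕ → List ℕ → Set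
InA n x = length x ≡ n × AscSeq x × Avoids x (0 ∷ 0 ∷ 1 ∷ []) × Avoids x (1 ∷ 0 ∷ 0 ∷ [])

-- Every ascent sequence starts with 0, and in a 001- and 100-avoiding one of
-- length n + 2 the second letter is 0 or 1.  If it is 0, avoiding 001 forces
-- all letters to be 0.  If it is 1, every later letter is positive except
-- possibly the last one: a 0 followed by some c would complete 001 (c > 0,
-- with the initial 0) or 100 (c = 0, with the 1).  Removing the initial 0,
-- the possible trailing 0, and subtracting 1 from the remaining letters yields
-- a shorter sequence w of the class, so the sequence is 0(w+1) or 0(w+1)0.
-- Both constructions preserve the class, giving a(n+2) = 1 + a(n+1) + a(n)
-- with a(0) = 0 and a(1) = 1; hence a(n) + 1 is the Fibonacci number F(n+2).
module Submission where

open import Defs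
open import Data.Empty using (⊥-elim)
open import Data.Fin using (Fin; cast) renaming (zero to #0; suc to #suc)
open import Data.List using (List; []; _∷_; _++_; [_]; map; replicate; length; lookup)
open import Data.List.Properties
  using (length-map; length-++; length-replicate; ++-identityʳ; ++-assoc; ∷-injectiveʳ; ∷ʳ-injective; ∷ʳ-injectiveˡ;
         map-injective)
open import Data.List.Membership.Propositional using (_∈_)
open import Data.List.Membership.Propositional.Properties using (∈-map⁺; ∈-map⁻; ∈-++⁺ˡ; ∈-++⁺ʳ; ∈-++⁻)
open import Data.List.Relation.Binary.Sublist.Propositional using (_⊆_; []; _∷_; _∷ʳ_; ⊆-refl; ⊆-trans; minimum)
open import Data.List.Relation.Binary.Sublist.Propositional.Properties using (map⁺; ++⁺ʳ; All-resp-⊆)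
open import Data.List.Relation.Unary.All as All using (All; []; _∷_)
open import Data.List.Relation.Unary.All.Properties using (replicate⁺) renaming (map⁺ to All-map⁺; ++⁺ to All-++⁺)
open import Data.List.Relation.Unary.AllPairs using ([]; _∷_)
open import Data.List.Relation.Unary.Any using (here; there)
open import Data.List.Relation.Unary.Unique.Propositional using (Unique)
import Data.List.Relation.Unary.Unique.Propositional.Properties as Unique
open import Data.Nat using (ℕ; zero; suc; _+_; _∸_; _≤_; _<_; _<?_; z≤n; s≤s; s≤s⁻¹; s<s⁻¹)
open import Data.Nat.Properties
  using (<-cmp; <-irrefl; <-asym; n≮0; suc-injective; +-identityʳ; +-assoc; +-comm; +-cancelˡ-≡; m+n∸n≡m)
open import Data.Nat.Tactic.RingSolver using (solve-∀)
open import Data.Product using (Σ; _×_; _,_; proj₁; proj₂; ∃-syntax)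
open import Data.Sum as Sum using (_⊎_; inj₁; inj₂)
open import Data.Unit using (⊤; tt)
open import Function.Bundles using (_⇔_; mk⇔; Equivalence)
open import Relation.Binary.Definitions using (tri<; tri≈; tri>)
open import Relation.Binary.PropositionalEquality
  using (_≡_; _≢_; refl; sym; trans; cong; cong₂; subst; subst₂; module ≡-Reasoning)
open import Relation.Nullary using (¬_; yes; no)

isAsc-< : ∀ {x y} → x < y → isAsc x y ≡ 1
isAsc-< {x} {y} x<y with x <? y
... | yes _ = refl
... | no x≮y = ⊥-elim (x≮y x<y)

isAsc-≮ : ∀ {x y} → ¬ x < y → isAsc x y ≡ 0
isAsc-≮ {x} {y} x≮y with x <? y
... | yes x<y = ⊥-elim (x≮y x<y)
... | no _ = refl

isAsc-suc : ∀ x y → isAsc (suc x) (suc y) ≡ isAsc x y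
isAsc-suc x y with <-cmp x y
... | tri< x<y _ _ = trans (isAsc-< (s≤s x<y)) (sym (isAsc-< x<y))
... | tri≈ x≮y _ _ = trans (isAsc-≮ (λ lt → x≮y (s<s⁻¹ lt))) (sym (isAsc-≮ x≮y))
... | tri> x≮y _ _ = trans (isAsc-≮ (λ lt → x≮y (s<s⁻¹ lt))) (sym (isAsc-≮ x≮y))

last∷ : ℕ → List ℕ → ℕ
last∷ h [] = h
last∷ h (x ∷ r) = last∷ x r

last∷-++ : ∀ h r y → last∷ h (r ++ [ y ]) ≡ y
last∷-++ h [] y = refl
last∷-++ h (x ∷ r) y = last∷-++ x r y

asc-++ : ∀ h r y → asc (h ∷ r ++ [ y ]) ≡ asc (h ∷ r) + isAsc (last∷ h r) y
asc-++ h [] y = +-identityʳ (isAsc h y)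
asc-++ h (x ∷ r) y = trans (cong (isAsc h x +_) (asc-++ x r y)) (sym (+-assoc (isAsc h x) _ _))

-- Continuation a l t: the word t may be appended, letter by letter, to an
-- ascent sequence with a ascents and last letter l.
Continuation : ℕ → ℕ → List ℕ → Set
Continuation a l [] = ⊤
Continuation a l (y ∷ t) = y ≤ suc a × Continuation (a + isAsc l y) y t

continuation-++ : ∀ a l t z → Continuation a l t → z ≤ suc (a + asc (l ∷ t)) → Continuation a l (t ++ [ z ])
continuation-++ a l [] z _ z≤ = subst (λ k → z ≤ suc k) (+-identityʳ a) z≤ , tt
continuation-++ a l (y ∷ t) z (y≤ , C) z≤ =
  y≤ , continuation-++ (a + isAsc l y) y t z C (subst (λ k → z ≤ suc k) (sym (+-assoc a (isAsc l y) _)) z≤)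

ascSeq-continuation : ∀ {x} → AscSeq x → ∃[ t ] x ≡ 0 ∷ t × Continuation 0 0 t
ascSeq-continuation first = [] , refl , tt
ascSeq-continuation (snoc z A z≤) with ascSeq-continuation A
... | t , refl , C = t ++ [ z ] , refl , continuation-++ 0 0 t z C z≤

ascSeq-++ : ∀ {h} r t → AscSeq (h ∷ r) → Continuation (asc (h ∷ r)) (last∷ h r) t → AscSeq (h ∷ r ++ t)
ascSeq-++ {h} r [] A _ = subst (λ z → AscSeq (h ∷ z)) (sym (++-identityʳ r)) A
ascSeq-++ {h} r (y ∷ t) A (y≤ , C) =
  subst (λ z → AscSeq (h ∷ z)) (++-assoc r [ y ] t)
    (ascSeq-++ (r ++ [ y ]) t (snoc y A y≤)
      (subst₂ (λ a l → Continuation a l t) (sym (asc-++ h r y)) (sym (last∷-++ h r y)) C))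

continuation-ascSeq : ∀ t → Continuation 0 0 t → AscSeq (0 ∷ t)
continuation-ascSeq t = ascSeq-++ [] t first

continuation-map-suc⁺ : ∀ a l t → Continuation a l t → Continuation (suc a) (suc l) (map suc t)
continuation-map-suc⁺ a l [] _ = tt
continuation-map-suc⁺ a l (y ∷ t) (y≤ , C) rewrite isAsc-suc l y =
  s≤s y≤ , continuation-map-suc⁺ (a + isAsc l y) y t C

continuation-map-suc⁻ : ∀ a l t → Continuation (suc a) (suc l) (map suc t) → Continuation a l t
continuation-map-suc⁻ a l [] _ = tt
continuation-map-suc⁻ a l (y ∷ t) (y≤ , C) rewrite isAsc-suc l y =
  s≤s⁻¹ y≤ , continuation-map-suc⁻ (a + isAsc l y) y t C

continuation-++⁻ : ∀ a l t u → Continuation a l (t ++ u) → Continuation a l t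
continuation-++⁻ a l [] u _ = tt
continuation-++⁻ a l (y ∷ t) u (y≤ , C) = y≤ , continuation-++⁻ (a + isAsc l y) y t u C

continuation-zeros : ∀ m → Continuation 0 0 (replicate m 0)
continuation-zeros zero = tt
continuation-zeros (suc m) = z≤n , continuation-zeros m

lift : List ℕ → List ℕ
lift w = 0 ∷ map suc w

lift₀ : List ℕ → List ℕ
lift₀ w = lift w ++ [ 0 ]

ascSeq-lift : ∀ {w} → AscSeq w → AscSeq (lift w)
ascSeq-lift A with ascSeq-continuation A
... | t , refl , C = continuation-ascSeq (map suc (0 ∷ t)) (s≤s z≤n , continuation-map-suc⁺ 0 0 t C)

ascSeq-lift⁻ : ∀ W u → AscSeq (lift (0 ∷ W) ++ u) → AscSeq (0 ∷ W)
ascSeq-lift⁻ W u A with ascSeq-continuation A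
... | ._ , refl , (_ , C) =
  continuation-ascSeq W (continuation-map-suc⁻ 0 0 W (continuation-++⁻ 1 1 (map suc W) u C))

ascSeq-zeros : ∀ m → AscSeq (replicate (suc m) 0)
ascSeq-zeros m = continuation-ascSeq (replicate m 0) (continuation-zeros m)

Avoids001 : List ℕ → Set
Avoids001 x = ∀ {a c} → a < c → ¬ (a ∷ a ∷ c ∷ []) ⊆ x

Avoids100 : List ℕ → Set
Avoids100 x = ∀ {a c} → c < a → ¬ (a ∷ c ∷ c ∷ []) ⊆ x

SameOrder : ℕ → ℕ → ℕ → ℕ → Set
SameOrder x y p q = ((x < y) ⇔ (p < q)) × ((x ≡ y) ⇔ (p ≡ q))

sameOrder-≡ : ∀ {x p} → SameOrder x x p p
sameOrder-≡ = mk⇔ (λ x<x → ⊥-elim (<-irrefl refl x<x)) (λ p<p → ⊥-elim (<-irrefl refl p<p)) ,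
              mk⇔ (λ _ → refl) (λ _ → refl)

sameOrder-< : ∀ {x y p q} → x < y → p < q → SameOrder x y p q
sameOrder-< x<y p<q = mk⇔ (λ _ → p<q) (λ _ → x<y) ,
                      mk⇔ (λ x≡y → ⊥-elim (<-irrefl x≡y x<y)) (λ p≡q → ⊥-elim (<-irrefl p≡q p<q))

sameOrder-> : ∀ {x y p q} → y < x → q < p → SameOrder x y p q
sameOrder-> y<x q<p = mk⇔ (λ x<y → ⊥-elim (<-asym x<y y<x)) (λ p<q → ⊥-elim (<-asym p<q q<p)) ,
                      mk⇔ (λ x≡y → ⊥-elim (<-irrefl (sym x≡y) y<x)) (λ p≡q → ⊥-elim (<-irrefl (sym p≡q) q<p))

orderIso-001 : ∀ {a c} → a < c → OrderIso (a ∷ a ∷ c ∷ []) (0 ∷ 0 ∷ 1 ∷ [])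
orderIso-001 {a} {c} a<c = refl , same
  where
  y p : List ℕ
  y = a ∷ a ∷ c ∷ []
  p = 0 ∷ 0 ∷ 1 ∷ []
  same : (s t : Fin 3) → SameOrder (lookup y s) (lookup y t) (lookup p (cast refl s)) (lookup p (cast refl t))
  same #0               #0               = sameOrder-≡
  same #0               (#suc #0)        = sameOrder-≡
  same #0               (#suc (#suc #0)) = sameOrder-< a<c (s≤s z≤n)
  same (#suc #0)        #0               = sameOrder-≡
  same (#suc #0)        (#suc #0)        = sameOrder-≡
  same (#suc #0)        (#suc (#suc #0)) = sameOrder-< a<c (s≤s z≤n)
  same (#suc (#suc #0)) #0               = sameOrder-> a<c (s≤s z≤n)
  same (#suc (#suc #0)) (#suc #0)        = sameOrder-> a<c (s≤s z≤n)
  same (#suc (#suc #0)) (#suc (#suc #0)) = sameOrder-≡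

orderIso-100 : ∀ {a c} → c < a → OrderIso (a ∷ c ∷ c ∷ []) (1 ∷ 0 ∷ 0 ∷ [])
orderIso-100 {a} {c} c<a = refl , same
  where
  y p : List ℕ
  y = a ∷ c ∷ c ∷ []
  p = 1 ∷ 0 ∷ 0 ∷ []
  same : (s t : Fin 3) → SameOrder (lookup y s) (lookup y t) (lookup p (cast refl s)) (lookup p (cast refl t))
  same #0               #0               = sameOrder-≡
  same #0               (#suc #0)        = sameOrder-> c<a (s≤s z≤n)
  same #0               (#suc (#suc #0)) = sameOrder-> c<a (s≤s z≤n)
  same (#suc #0)        #0               = sameOrder-< c<a (s≤s z≤n)
  same (#suc #0)        (#suc #0)        = sameOrder-≡
  same (#suc #0)        (#suc (#suc #0)) = sameOrder-≡
  same (#suc (#suc #0)) #0               = sameOrder-< c<a (s≤s z≤n)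
  same (#suc (#suc #0)) (#suc #0)        = sameOrder-≡
  same (#suc (#suc #0)) (#suc (#suc #0)) = sameOrder-≡

avoids001⇔ : ∀ {x} → Avoids x (0 ∷ 0 ∷ 1 ∷ []) ⇔ Avoids001 x
avoids001⇔ {x} = mk⇔ (λ av {_} {_} a<c sub → av (_ , sub , orderIso-001 a<c)) from
  where
  from : Avoids001 x → Avoids x (0 ∷ 0 ∷ 1 ∷ [])
  from av ((a ∷ b ∷ c ∷ []) , sub , refl , iso) =
    av a<c (subst (λ z → (a ∷ z ∷ c ∷ []) ⊆ x) (sym a≡b) sub)
    where
    a≡b : a ≡ b
    a≡b = Equivalence.from (proj₂ (iso #0 (#suc #0))) refl
    a<c : a < c
    a<c = Equivalence.from (proj₁ (iso #0 (#suc (#suc #0)))) (s≤s z≤n)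

avoids100⇔ : ∀ {x} → Avoids x (1 ∷ 0 ∷ 0 ∷ []) ⇔ Avoids100 x
avoids100⇔ {x} = mk⇔ (λ av {_} {_} c<a sub → av (_ , sub , orderIso-100 c<a)) from
  where
  from : Avoids100 x → Avoids x (1 ∷ 0 ∷ 0 ∷ [])
  from av ((a ∷ b ∷ c ∷ []) , sub , refl , iso) =
    av c<a (subst (λ z → (a ∷ z ∷ c ∷ []) ⊆ x) b≡c sub)
    where
    b≡c : b ≡ c
    b≡c = Equivalence.from (proj₂ (iso (#suc #0) (#suc (#suc #0)))) refl
    c<a : c < a
    c<a = Equivalence.from (proj₁ (iso (#suc (#suc #0)) #0)) (s≤s z≤n)

⊆-map⁻ : ∀ {A B : Set} (f : A → B) {ys} xs → ys ⊆ map f xs → ∃[ zs ] ys ≡ map f zs × zs ⊆ xs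
⊆-map⁻ f [] [] = [] , refl , []
⊆-map⁻ f (x ∷ xs) (_ ∷ʳ sub) with ⊆-map⁻ f xs sub
... | zs , eq , sub′ = zs , eq , x ∷ʳ sub′
⊆-map⁻ f (x ∷ xs) (refl ∷ sub) with ⊆-map⁻ f xs sub
... | zs , refl , sub′ = x ∷ zs , refl , refl ∷ sub′

⊆-++[]⁻ : ∀ {A : Set} {ys} (xs : List A) z → ys ⊆ xs ++ [ z ] →
  ys ⊆ xs ⊎ ∃[ ys′ ] ys ≡ ys′ ++ [ z ] × ys′ ⊆ xs
⊆-++[]⁻ [] z (_ ∷ʳ []) = inj₁ []
⊆-++[]⁻ [] z (refl ∷ []) = inj₂ ([] , refl , [])
⊆-++[]⁻ (x ∷ xs) z (_ ∷ʳ sub) =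
  Sum.map (x ∷ʳ_) (λ (ys′ , eq , sub′) → ys′ , eq , x ∷ʳ sub′) (⊆-++[]⁻ xs z sub)
⊆-++[]⁻ (x ∷ xs) z (refl ∷ sub) =
  Sum.map (refl ∷_) (λ (ys′ , eq , sub′) → x ∷ ys′ , cong (x ∷_) eq , refl ∷ sub′) (⊆-++[]⁻ xs z sub)

map-suc-positive : ∀ w → All (0 <_) (map suc w)
map-suc-positive w = All-map⁺ (All.universal (λ _ → s≤s z≤n) w)

0∷⊈map-suc : ∀ {r} w → ¬ (0 ∷ r) ⊆ map suc w
0∷⊈map-suc w sub with All-resp-⊆ sub (map-suc-positive w)
... | () ∷ _

later-0⊈lift : ∀ {a} w → ¬ (a ∷ 0 ∷ []) ⊆ lift w
later-0⊈lift w (_ ∷ʳ sub) with All-resp-⊆ sub (map-suc-positive w)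
... | _ ∷ () ∷ []
later-0⊈lift w (refl ∷ sub) = 0∷⊈map-suc w sub

avoids001-map-suc : ∀ {w} → Avoids001 w → Avoids001 (map suc w)
avoids001-map-suc {w} av a<c sub with ⊆-map⁻ suc w sub
... | (_ ∷ _ ∷ _ ∷ []) , refl , sub′ = av (s<s⁻¹ a<c) sub′

avoids100-map-suc : ∀ {w} → Avoids100 w → Avoids100 (map suc w)
avoids100-map-suc {w} av c<a sub with ⊆-map⁻ suc w sub
... | (_ ∷ _ ∷ _ ∷ []) , refl , sub′ = av (s<s⁻¹ c<a) sub′

avoids001-map-suc⁻ : ∀ {w x} → map suc w ⊆ x → Avoids001 x → Avoids001 w
avoids001-map-suc⁻ w⊆x av a<c sub = av (s≤s a<c) (⊆-trans (map⁺ suc sub) w⊆x)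

avoids100-map-suc⁻ : ∀ {w x} → map suc w ⊆ x → Avoids100 x → Avoids100 w
avoids100-map-suc⁻ w⊆x av c<a sub = av (s≤s c<a) (⊆-trans (map⁺ suc sub) w⊆x)

avoids001-lift : ∀ {w} → Avoids001 w → Avoids001 (lift w)
avoids001-lift av a<c (_ ∷ʳ sub) = avoids001-map-suc av a<c sub
avoids001-lift {w} av a<c (refl ∷ sub) = 0∷⊈map-suc w sub

avoids100-lift : ∀ {w} → Avoids100 w → Avoids100 (lift w)
avoids100-lift av c<a (_ ∷ʳ sub) = avoids100-map-suc av c<a sub
avoids100-lift av c<a (refl ∷ sub) = n≮0 c<a

avoids001-lift₀ : ∀ {w} → Avoids001 w → Avoids001 (lift₀ w)
avoids001-lift₀ {w} av {a} a<c sub with ⊆-++[]⁻ (lift w) 0 sub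
... | inj₁ sub′ = avoids001-lift av a<c sub′
... | inj₂ (ys , eq , _) with ∷ʳ-injective (a ∷ a ∷ []) ys eq
...   | _ , refl = n≮0 a<c

avoids100-lift₀ : ∀ {w} → Avoids100 w → Avoids100 (lift₀ w)
avoids100-lift₀ {w} av {a} {c} c<a sub with ⊆-++[]⁻ (lift w) 0 sub
... | inj₁ sub′ = avoids100-lift av c<a sub′
... | inj₂ (ys , eq , sub′) with ∷ʳ-injective (a ∷ c ∷ []) ys eq
...   | refl , refl = later-0⊈lift w sub′

avoids001-zeros : ∀ m → Avoids001 (replicate m 0)
avoids001-zeros m a<c sub with All-resp-⊆ sub (replicate⁺ {P = _≡ 0} m refl)
... | refl ∷ _ ∷ refl ∷ [] = <-irrefl refl a<c

avoids100-zeros : ∀ m → Avoids100 (replicate m 0)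
avoids100-zeros m c<a sub with All-resp-⊆ sub (replicate⁺ {P = _≡ 0} m refl)
... | refl ∷ refl ∷ _ ∷ [] = <-irrefl refl c<a

zeros-after-00 : ∀ t → Avoids001 (0 ∷ 0 ∷ t) → t ≡ replicate (length t) 0
zeros-after-00 [] _ = refl
zeros-after-00 (zero ∷ t) av =
  cong (0 ∷_) (zeros-after-00 t (λ a<c sub → av a<c (⊆-trans sub (refl ∷ refl ∷ 0 ∷ʳ ⊆-refl))))
zeros-after-00 (suc c ∷ t) av = ⊥-elim (av (s≤s z≤n) (refl ∷ refl ∷ refl ∷ minimum t))

map-suc-or-trailing-0 : ∀ s → (∀ c → ¬ (0 ∷ c ∷ []) ⊆ s) →
  ∃[ W ] (s ≡ map suc W ⊎ s ≡ map suc W ++ [ 0 ])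
map-suc-or-trailing-0 [] _ = [] , inj₁ refl
map-suc-or-trailing-0 (zero ∷ []) _ = [] , inj₂ refl
map-suc-or-trailing-0 (zero ∷ c ∷ s) 0-last = ⊥-elim (0-last c (refl ∷ refl ∷ minimum s))
map-suc-or-trailing-0 (suc y ∷ s) 0-last with map-suc-or-trailing-0 s (λ c sub → 0-last c (suc y ∷ʳ sub))
... | W , eq = y ∷ W , Sum.map (cong (suc y ∷_)) (cong (suc y ∷_)) eq

record Avoider (n : ℕ) (x : List ℕ) : Set where
  constructor avoider
  field
    length≡   : length x ≡ n
    ascSeq    : AscSeq x
    avoids001 : Avoids001 x
    avoids100 : Avoids100 x

inA⇔avoider : ∀ {n x} → InA n x ⇔ Avoider n x
inA⇔avoider = mk⇔
  (λ (len , A , av₁ , av₂) → avoider len A (Equivalence.to avoids001⇔ av₁) (Equivalence.to avoids100⇔ av₂))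
  (λ (avoider len A av₁ av₂) → len , A , Equivalence.from avoids001⇔ av₁ , Equivalence.from avoids100⇔ av₂)

length-lift-++ : ∀ w u → length (lift w ++ u) ≡ length u + suc (length w)
length-lift-++ w u = begin
  length (lift w ++ u)                ≡⟨ length-++ (lift w) ⟩
  suc (length (map suc w)) + length u ≡⟨ cong (λ k → suc k + length u) (length-map suc w) ⟩
  suc (length w) + length u           ≡⟨ +-comm (suc (length w)) (length u) ⟩
  length u + suc (length w)           ∎
  where open ≡-Reasoning

avoider-zeros : ∀ m → Avoider (suc m) (replicate (suc m) 0)
avoider-zeros m =
  avoider (length-replicate (suc m)) (ascSeq-zeros m) (avoids001-zeros (suc m)) (avoids100-zeros (suc m))

avoider-lift : ∀ {m w} → Avoider m w → Avoider (suc m) (lift w)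
avoider-lift {w = w} (avoider refl A av₁ av₂) =
  avoider (cong suc (length-map suc w)) (ascSeq-lift A) (avoids001-lift av₁) (avoids100-lift av₂)

avoider-lift₀ : ∀ {m w} → Avoider m w → Avoider (suc (suc m)) (lift₀ w)
avoider-lift₀ {w = w} (avoider refl A av₁ av₂) =
  avoider (length-lift-++ w [ 0 ]) (snoc 0 (ascSeq-lift A) z≤n) (avoids001-lift₀ av₁) (avoids100-lift₀ av₂)

avoider-lift⁻ : ∀ {m} W u → Avoider (length u + suc m) (lift (0 ∷ W) ++ u) → Avoider m (0 ∷ W)
avoider-lift⁻ W u (avoider len A av₁ av₂) = avoider
  (suc-injective (+-cancelˡ-≡ (length u) _ _ (trans (sym (length-lift-++ (0 ∷ W) u)) len)))
  (ascSeq-lift⁻ W u A)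
  (avoids001-map-suc⁻ lifted⊆ av₁)
  (avoids100-map-suc⁻ lifted⊆ av₂)
  where
  lifted⊆ : map suc (0 ∷ W) ⊆ lift (0 ∷ W) ++ u
  lifted⊆ = 0 ∷ʳ ++⁺ʳ u ⊆-refl

avoider-split : ∀ {n x} → Avoider (suc (suc n)) x →
  x ≡ replicate (suc (suc n)) 0
  ⊎ (∃[ w ] Avoider (suc n) w × x ≡ lift w)
  ⊎ (∃[ w ] Avoider n w × x ≡ lift₀ w)
avoider-split a with ascSeq-continuation (Avoider.ascSeq a)
avoider-split (avoider () _ _ _) | [] , refl , _
avoider-split (avoider len _ av₁ _) | 0 ∷ t , refl , _ =
  inj₁ (cong (λ t → 0 ∷ 0 ∷ t)
    (trans (zeros-after-00 t av₁) (cong (λ k → replicate k 0) (suc-injective (suc-injective len)))))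
avoider-split _ | suc (suc _) ∷ _ , refl , (s≤s () , _)
avoider-split a@(avoider _ _ av₁ av₂) | 1 ∷ s , refl , _ with map-suc-or-trailing-0 s 0-last
  where
  0-last : ∀ c → ¬ (0 ∷ c ∷ []) ⊆ s
  0-last zero sub = av₂ (s≤s z≤n) (0 ∷ʳ refl ∷ sub)
  0-last (suc c) sub = av₁ (s≤s z≤n) (refl ∷ 1 ∷ʳ sub)
... | W , inj₁ refl = inj₂ (inj₁ (0 ∷ W , avoider-lift⁻ W [] (subst (Avoider _) (sym (++-identityʳ _)) a) , refl))
... | W , inj₂ refl = inj₂ (inj₂ (0 ∷ W , avoider-lift⁻ W [ 0 ] a , refl))

enum : ℕ → List (List ℕ)
enum zero = []
enum (suc zero) = [ [ 0 ] ]
enum (suc (suc n)) = replicate (suc (suc n)) 0 ∷ map lift (enum (suc n)) ++ map lift₀ (enum n)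

enum-sound : ∀ n → All (Avoider n) (enum n)
enum-sound zero = []
enum-sound (suc zero) = avoider-zeros 0 ∷ []
enum-sound (suc (suc n)) = avoider-zeros (suc n) ∷
  All-++⁺ (All-map⁺ (All.map avoider-lift (enum-sound (suc n)))) (All-map⁺ (All.map avoider-lift₀ (enum-sound n)))

enum-complete-step : ∀ {n x} →
  (∀ {w} → Avoider (suc n) w → w ∈ enum (suc n)) → (∀ {w} → Avoider n w → w ∈ enum n) →
  Avoider (suc (suc n)) x → x ∈ enum (suc (suc n))
enum-complete-step {n} complete₁ complete₀ a with avoider-split a
... | inj₁ refl = here refl
... | inj₂ (inj₁ (w , aw , refl)) = there (∈-++⁺ˡ (∈-map⁺ lift (complete₁ aw)))
... | inj₂ (inj₂ (w , aw , refl)) = there (∈-++⁺ʳ (map lift (enum (suc n))) (∈-map⁺ lift₀ (complete₀ aw)))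

enum-complete : ∀ n {x} → Avoider n x → x ∈ enum n
enum-complete zero a with ascSeq-continuation (Avoider.ascSeq a)
enum-complete zero (avoider () _ _ _) | _ , refl , _
enum-complete (suc zero) a with ascSeq-continuation (Avoider.ascSeq a)
enum-complete (suc zero) _ | [] , refl , _ = here refl
enum-complete (suc zero) (avoider () _ _ _) | _ ∷ _ , refl , _
enum-complete (suc (suc n)) = enum-complete-step (enum-complete (suc n)) (enum-complete n)

enum-head : ∀ n {w} → w ∈ enum n → ∃[ t ] w ≡ 0 ∷ t
enum-head n w∈ with ascSeq-continuation (Avoider.ascSeq (All.lookup (enum-sound n) w∈))
... | t , eq , _ = t , eq

lift-injective : ∀ {v w} → lift v ≡ lift w → v ≡ w
lift-injective eq = map-injective suc-injective (∷-injectiveʳ eq)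

lift₀-injective : ∀ {v w} → lift₀ v ≡ lift₀ w → v ≡ w
lift₀-injective {v} {w} eq = map-injective suc-injective (∷ʳ-injectiveˡ (map suc v) (map suc w) (∷-injectiveʳ eq))

lift≢lift₀ : ∀ v w → lift v ≢ lift₀ w
lift≢lift₀ v w eq with ∈-map⁻ suc (subst (0 ∈_) (sym (∷-injectiveʳ eq)) (∈-++⁺ʳ (map suc w) (here refl)))
... | _ , _ , ()

zeros≢0∷1∷ : ∀ m v → replicate m 0 ≢ 0 ∷ 1 ∷ v
zeros≢0∷1∷ zero _ ()
zeros≢0∷1∷ (suc zero) _ ()
zeros≢0∷1∷ (suc (suc _)) _ ()

enum-unique : ∀ n → Unique (enum n)
enum-unique zero = []
enum-unique (suc zero) = [] ∷ []
enum-unique (suc (suc n)) =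
  All.tabulate zeros∉ ∷ Unique.++⁺ (Unique.map⁺ lift-injective (enum-unique (suc n)))
                                   (Unique.map⁺ lift₀-injective (enum-unique n)) disjoint
  where
  zeros∉ : ∀ {y} → y ∈ map lift (enum (suc n)) ++ map lift₀ (enum n) → replicate (suc (suc n)) 0 ≢ y
  zeros∉ y∈ with ∈-++⁻ (map lift (enum (suc n))) y∈
  ... | inj₁ y∈₁ with ∈-map⁻ lift y∈₁
  ...   | w , w∈ , refl with enum-head (suc n) w∈
  ...     | t , refl = zeros≢0∷1∷ (suc (suc n)) (map suc t)
  zeros∉ y∈ | inj₂ y∈₂ with ∈-map⁻ lift₀ y∈₂
  ...   | w , w∈ , refl with enum-head n w∈
  ...     | t , refl = zeros≢0∷1∷ (suc (suc n)) (map suc t ++ [ 0 ])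
  disjoint : ∀ {v} → ¬ (v ∈ map lift (enum (suc n)) × v ∈ map lift₀ (enum n))
  disjoint (v∈₁ , v∈₂) with ∈-map⁻ lift v∈₁ | ∈-map⁻ lift₀ v∈₂
  ... | w₁ , _ , refl | w₂ , _ , eq = lift≢lift₀ w₁ w₂ eq

length-enum : ∀ n → length (enum n) + 1 ≡ fib (n + 2)
length-enum zero = refl
length-enum (suc zero) = refl
length-enum (suc (suc n)) = begin
  suc (length (map lift (enum (suc n)) ++ map lift₀ (enum n))) + 1
    ≡⟨ cong (λ k → suc k + 1) (length-++ (map lift (enum (suc n)))) ⟩
  suc (length (map lift (enum (suc n))) + length (map lift₀ (enum n))) + 1
    ≡⟨ cong₂ (λ a b → suc (a + b) + 1) (length-map lift (enum (suc n))) (length-map lift₀ (enum n)) ⟩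
  suc (length (enum (suc n)) + length (enum n)) + 1
    ≡⟨ regroup (length (enum (suc n))) (length (enum n)) ⟩
  (length (enum (suc n)) + 1) + (length (enum n) + 1)
    ≡⟨ cong₂ _+_ (length-enum (suc n)) (length-enum n) ⟩
  fib (suc n + 2) + fib (n + 2) ∎
  where
  open ≡-Reasoning
  regroup : ∀ a b → suc (a + b) + 1 ≡ (a + 1) + (b + 1)
  regroup = solve-∀

∈-enum⇔ : ∀ n x → x ∈ enum n ⇔ InA n x
∈-enum⇔ n x = mk⇔ (λ x∈ → Equivalence.from inA⇔avoider (All.lookup (enum-sound n) x∈))
                  (λ inA → enum-complete n (Equivalence.to inA⇔avoider inA))

proposition2p12 : (n : ℕ) → 1 ≤ n →
    Σ (List (List ℕ)) λ xs →
      Unique xs × (∀ x → (x ∈ xs) ⇔ InA n x) × (length xs ≡ fib (n + 2) ∸ 1)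
proposition2p12 n _ = enum n , enum-unique n , ∈-enum⇔ n , length≡
  where
  length≡ : length (enum n) ≡ fib (n + 2) ∸ 1
  length≡ = trans (sym (m+n∸n≡m (length (enum n)) 1)) (cong (_∸ 1) (length-enum n))
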